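{- Let $H=(V,\mathcal{E})$ be an acyclic hypergraph with $m$ hyperedges and $T$ a join tree for $H$. Root $T$ at an arbitrary hyperedge $R$ and let $\langle R=E_1,\dots,E_m\rangle$ be a pre-order of $T$. For each vertex $v$ let $\lambda(v)=\min\{i : v\in E_i\}$. For $i=2,\dots,m$ in this order, set $S^{\uparrow}(E_i)=\{v\in E_i:\lambda(v)<i\}$, let $j=\max\{\lambda(v):v\in S^{\uparrow}(E_i)\}$, and make $E_j$ the parent of $E_i$; let $T'$ be the resulting tree. Let $E_a$ and $E_b$ be two distinct hyperedges of $H$, let $P_{ab}$ be the path from $E_a$ to $E_b$ in $T'$, and let $S_a$ and $S_b$ be the separators on $P_{ab}$ closest to $E_a$ and $E_b$, respectively. Then there are at most two separators $S$ on $P_{ab}$ such that $S\subseteq S_a$ and $S\subseteq S_b$.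
   Context: Hypergraphs have nonempty hyperedges, distinct hyperedges may be equal as sets, and the incidence graph is connected. A join tree for $H$ is a tree whose nodes are the hyperedges such that, for every vertex $v$, the hyperedges containing $v$ induce a connected subtree; $H$ is acyclic if it has a join tree. The separator of an edge $XY$ of a tree on the hyperedges is $X\cap Y$; the separators on a path are those of its edges, counted per edge, and the separator closest to an endpoint is that of the path edge incident to it. -}

module Defs where

open import Data.Nat using (ℕ; zero; suc; _<_; _≤_)
open import Data.Fin using (Fin; zero; suc; toℕ; inject₁; fromℕ)
open import Data.Fin.Subset using (Subset; _∈_; _∩_; _⊆_; Nonempty)
open import Data.Sum using (_⊎_; inj₁; inj₂)
open import Data.Product using (Σ; ∃; _×_; _,_)
open import Relation.Binary.PropositionalEquality using (_≡_)
open import Relation.Binary.Construct.Closure.ReflexiveTransitive using (Star)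
open import Function.Definitions using (Injective)
open import Data.Empty using (⊥)

-- A hypergraph with vertex set Fin n and m hyperedges indexed by Fin m
-- (hyperedges are a family, so two of them may be equal as sets).
Hypergraph : ℕ → ℕ → Set
Hypergraph n m = Fin m → Subset n

IncAdj : ∀ {n m} → Hypergraph n m → Fin n ⊎ Fin m → Fin n ⊎ Fin m → Set
IncAdj E (inj₁ v) (inj₂ e) = v ∈ E e
IncAdj E (inj₂ e) (inj₁ v) = v ∈ E e
IncAdj E _ _ = ⊥

IncidenceConnected : ∀ {n m} → Hypergraph n m → Set
IncidenceConnected {n} {m} E = (x y : Fin n ⊎ Fin m) → Star (IncAdj E) x y

IsHypergraph : ∀ {n m} → Hypergraph n m → Set
IsHypergraph {n} {m} E = ((e : Fin m) → Nonempty (E e)) × IncidenceConnected E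

-- Rooted trees on the nodes Fin (suc k), given by a parent function:
-- node 0 is the root and the parent of node (suc c) is par c.

ParentFn : ℕ → Set
ParentFn k = Fin k → Fin (suc k)

ParentsEarlier : ∀ {k} → ParentFn k → Set
ParentsEarlier {k} par = (c : Fin k) → toℕ (par c) < toℕ (suc c)

TreeAdj : ∀ {k} → ParentFn k → Fin (suc k) → Fin (suc k) → Set
TreeAdj {k} par x y =
  (Σ (Fin k) λ c → x ≡ suc c × y ≡ par c) ⊎ (Σ (Fin k) λ c → y ≡ suc c × x ≡ par c)

data Desc {k} (par : ParentFn k) (i : Fin (suc k)) : Fin (suc k) → Set where
  here : Desc par i i
  step : ∀ {c} → Desc par i (par c) → Desc par i (suc c)

-- The numbering 0,1,…,k is a pre-order of the rooted tree: every node comes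
-- before its descendants and the subtree of every node occupies a contiguous
-- block of positions (starting at that node).
IsPreorder : ∀ {k} → ParentFn k → Set
IsPreorder {k} par = ParentsEarlier par ×
  ((i j l : Fin (suc k)) → toℕ i ≤ toℕ j → toℕ j ≤ toℕ l →
     Desc par i l → Desc par i j)

IsJoinTree : ∀ {n k} → Hypergraph n (suc k) → ParentFn k → Set
IsJoinTree {n} {k} E par = (v : Fin n) (i j : Fin (suc k)) → v ∈ E i → v ∈ E j →
  Star (λ x y → TreeAdj par x y × v ∈ E x × v ∈ E y) i j

IsLambda : ∀ {n m} → Hypergraph n m → (Fin n → Fin m) → Set
IsLambda {n} {m} E lam = (v : Fin n) → v ∈ E (lam v) ×
  ((i : Fin m) → v ∈ E i → toℕ (lam v) ≤ toℕ i)

IsNewParent : ∀ {n k} → Hypergraph n (suc k) → (Fin n → Fin (suc k)) → ParentFn k → Set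
IsNewParent {n} {k} E lam par' = (c : Fin k) →
  (Σ (Fin n) λ v → v ∈ E (suc c) × toℕ (lam v) < toℕ (suc c) × lam v ≡ par' c) ×
  ((v : Fin n) → v ∈ E (suc c) → toℕ (lam v) < toℕ (suc c) → toℕ (lam v) ≤ toℕ (par' c))

IsPath : ∀ {k} → ParentFn k → Fin (suc k) → Fin (suc k) → (r : ℕ) → (Fin (suc (suc r)) → Fin (suc k)) → Set
IsPath par a b r x = x zero ≡ a × x (fromℕ (suc r)) ≡ b × Injective _≡_ _≡_ x ×
  ((t : Fin (suc r)) → TreeAdj par (x (inject₁ t)) (x (suc t)))

Sep : ∀ {n k} → Hypergraph n (suc k) → (r : ℕ) → (Fin (suc (suc r)) → Fin (suc k)) → Fin (suc r) → Subset n
Sep E r x t = E (x (inject₁ t)) ∩ E (x (suc t))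

{-# OPTIONS --safe #-}
module Submission where

open import Defs
open import Data.Nat using (ℕ; suc)
import Data.Nat as ℕ using (_≤_; _<_)
import Data.Nat.Properties as ℕ
open import Data.Fin using (Fin; zero; suc; fromℕ; inject₁; toℕ; _<_; _≟_)
open import Data.Fin.Properties using (toℕ-injective; toℕ-inject₁)
open import Data.Fin.Induction using (<-wellFounded; <-weakInduction; >-weakInduction)
open import Data.Fin.Subset using (_∈_; _∩_; _⊆_)
open import Data.Fin.Subset.Properties using (x∈p∩q⁺; x∈p∩q⁻)
open import Data.Empty using (⊥; ⊥-elim)
open import Data.Product using (Σ; _×_; _,_; proj₁; proj₂)
open import Data.Sum using (_⊎_; inj₁; inj₂)
open import Function.Definitions using (Injective)
open import Induction.WellFounded using (module All)
open import Relation.Nullary using (yes; no)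
open import Relation.Binary.PropositionalEquality using (_≡_; _≢_; refl; sym; cong; subst)
open import Relation.Binary.Construct.Closure.ReflexiveTransitive using (Star; ε; _◅_)

-- In T and in T' alike, every hyperedge containing v lies in the subtree rooted at
-- E_λ(v).  The parent rule of T' puts into the separator of each edge of T' a vertex u
-- with λ(u) the upper end of that edge.  If the separator of a path edge is contained
-- in both end separators, this u lies in both end hyperedges, so the whole path lies in
-- the subtree rooted at an end of that edge.  Only one node of a tree path lies above
-- all the others, so all such separators are incident to it: there are at most two.

module _ {k : ℕ} {par : ParentFn k} where

  TreeAdj-sym : ∀ {y z} → TreeAdj par y z → TreeAdj par z y
  TreeAdj-sym (inj₁ e) = inj₂ e
  TreeAdj-sym (inj₂ e) = inj₁ e

  Desc-adj : ∀ {p y z} → Desc par p y → TreeAdj par y z → y ≢ p → Desc par p z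
  Desc-adj d        (inj₂ (c , refl , refl)) _   = step d
  Desc-adj here     (inj₁ (c , refl , refl)) y≢p = ⊥-elim (y≢p refl)
  Desc-adj (step d) (inj₁ (c , refl , refl)) _   = d

  module _ (earlier : ParentsEarlier par) where

    Desc⇒≤ : ∀ {p q} → Desc par p q → toℕ p ℕ.≤ toℕ q
    Desc⇒≤ here         = ℕ.≤-refl
    Desc⇒≤ (step {c} d) = ℕ.≤-trans (Desc⇒≤ d) (ℕ.<⇒≤ (earlier c))

    Desc-antisym : ∀ {p q} → Desc par p q → Desc par q p → p ≡ q
    Desc-antisym d e = toℕ-injective (ℕ.≤-antisym (Desc⇒≤ d) (Desc⇒≤ e))

    Desc-adj-≤ : ∀ {p y z} → Desc par p y → TreeAdj par y z → toℕ p ℕ.≤ toℕ z → Desc par p z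
    Desc-adj-≤ d        (inj₂ (c , refl , refl)) _   = step d
    Desc-adj-≤ here     (inj₁ (c , refl , refl)) p≤z = ⊥-elim (ℕ.<⇒≱ (earlier c) p≤z)
    Desc-adj-≤ (step d) (inj₁ (c , refl , refl)) _   = d

  module _ {r : ℕ} {x : Fin (suc (suc r)) → Fin (suc k)} (x-injective : Injective _≡_ _≡_ x)
           (x-adj : ∀ t → TreeAdj par (x (inject₁ t)) (x (suc t))) where

    path-below : ∀ s → Desc par (x s) (x zero) → Desc par (x s) (x (fromℕ (suc r))) →
                 ∀ i → Desc par (x s) (x i)
    path-below s below₀ belowₗ i with ℕ.≤-total (toℕ i) (toℕ s)
    ... | inj₁ i≤s = <-weakInduction Before (λ _ → below₀) forward i i≤s
      where
        Before : Fin (suc (suc r)) → Set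
        Before j = toℕ j ℕ.≤ toℕ s → Desc par (x s) (x j)
        forward : ∀ t → Before (inject₁ t) → Before (suc t)
        forward t before t<s =
          Desc-adj (before (ℕ.<⇒≤ t<s′)) (x-adj t) (λ e → ℕ.<⇒≢ t<s′ (cong toℕ (x-injective e)))
          where
            t<s′ : toℕ (inject₁ t) ℕ.< toℕ s
            t<s′ = subst (ℕ._< toℕ s) (sym (toℕ-inject₁ t)) t<s
    ... | inj₂ s≤i = >-weakInduction After (λ _ → belowₗ) backward i s≤i
      where
        After : Fin (suc (suc r)) → Set
        After j = toℕ s ℕ.≤ toℕ j → Desc par (x s) (x j)
        backward : ∀ t → After (suc t) → After (inject₁ t)
        backward t after s≤t =
          Desc-adj (after (ℕ.<⇒≤ s<t+1)) (TreeAdj-sym (x-adj t))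
                   (λ e → ℕ.<⇒≢ s<t+1 (sym (cong toℕ (x-injective e))))
          where
            s<t+1 : toℕ s ℕ.< toℕ (suc t)
            s<t+1 = ℕ.s≤s (subst (toℕ s ℕ.≤_) (toℕ-inject₁ t) s≤t)

module JoinTree {n k : ℕ} (E : Hypergraph n (suc k)) (par : ParentFn k)
  (join : IsJoinTree E par) (earlier : ParentsEarlier par)
  (lam : Fin n → Fin (suc k)) (isλ : IsLambda E lam) where

  Walk : Fin n → Fin (suc k) → Fin (suc k) → Set
  Walk v = Star (λ y z → TreeAdj par y z × v ∈ E y × v ∈ E z)

  λ-is-ancestor : ∀ {v i} → v ∈ E i → Desc par (lam v) i
  λ-is-ancestor {v} {i} v∈i = stays (join v (lam v) i (proj₁ (isλ v)) v∈i) here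
    where
      stays : ∀ {a b} → Walk v a b → Desc par (lam v) a → Desc par (lam v) b
      stays ε                   d = d
      stays ((adj , _ , v∈z) ◅ w) d = stays w (Desc-adj-≤ earlier d adj (proj₂ (isλ v) _ v∈z))

  walk-into-subtree : ∀ {v m a b} → Walk v a b → Desc par m b → v ∈ E m ⊎ Desc par m a
  walk-into-subtree ε d = inj₂ d
  walk-into-subtree {v} {m} (_◅_ {j = z} (adj , _ , v∈z) w) d with walk-into-subtree w d
  ... | inj₁ v∈m = inj₁ v∈m
  ... | inj₂ d′ with z ≟ m
  ...   | yes z≡m = inj₁ (subst (λ e → v ∈ E e) z≡m v∈z)
  ...   | no  z≢m = inj₂ (Desc-adj d′ (TreeAdj-sym adj) z≢m)

  running-intersection : ∀ {v w i} → v ∈ E i → w ∈ E i → toℕ (lam v) ℕ.≤ toℕ (lam w) →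
                         v ∈ E (lam w)
  running-intersection {v} {w} {i} v∈i w∈i λv≤λw with ℕ.m≤n⇒m<n∨m≡n λv≤λw
  ... | inj₂ λv≡λw = subst (λ e → v ∈ E e) (toℕ-injective λv≡λw) (proj₁ (isλ v))
  ... | inj₁ λv<λw
    -- the v-walk from E_λ(v) to E_i ends below E_λ(w) but cannot start there
    with walk-into-subtree (join v (lam v) i (proj₁ (isλ v)) v∈i) (λ-is-ancestor w∈i)
  ...   | inj₁ v∈λw = v∈λw
  ...   | inj₂ λw≤λv = ⊥-elim (ℕ.<⇒≱ λv<λw (Desc⇒≤ earlier λw≤λv))

  module NewParent (par′ : ParentFn k) (new : IsNewParent E lam par′) where

    earlier′ : ParentsEarlier par′
    earlier′ c with proj₁ (new c)
    ... | _ , _ , λu<c , λu≡par′c = subst (λ p → toℕ p ℕ.< toℕ (suc c)) λu≡par′c λu<c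

    S↑⊆E-par′ : ∀ {w c} → w ∈ E (suc c) → toℕ (lam w) ℕ.< toℕ (suc c) → w ∈ E (par′ c)
    S↑⊆E-par′ {w} {c} w∈c λw<c with proj₁ (new c)
    ... | u , u∈c , _ , λu≡par′c =
      subst (λ p → w ∈ E p) λu≡par′c
        (running-intersection w∈c u∈c
          (subst (λ p → toℕ (lam w) ℕ.≤ toℕ p) (sym λu≡par′c) (proj₂ (new c) w w∈c λw<c)))

    λ-is-ancestor′ : ∀ q {w} → w ∈ E q → Desc par′ (lam w) q
    λ-is-ancestor′ = All.wfRec <-wellFounded _ Below below
      where
        Below : Fin (suc k) → Set
        Below q = ∀ {w} → w ∈ E q → Desc par′ (lam w) q
        below : ∀ q → (∀ {p} → p < q → Below p) → Below q
        below zero _ {w} w∈0 =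
          subst (λ p → Desc par′ p zero)
                (sym (toℕ-injective (ℕ.n≤0⇒n≡0 (proj₂ (isλ w) zero w∈0)))) here
        below (suc c) below< {w} w∈c with lam w ≟ suc c
        ... | yes λw≡c = subst (λ p → Desc par′ p (suc c)) (sym λw≡c) here
        ... | no  λw≢c = step (below< (earlier′ c) (S↑⊆E-par′ w∈c λw<c))
          where
            λw<c : toℕ (lam w) ℕ.< toℕ (suc c)
            λw<c = ℕ.≤∧≢⇒< (proj₂ (isλ w) (suc c) w∈c) (λ e → λw≢c (toℕ-injective e))

    parent-witness : ∀ c → Σ (Fin n) λ u → u ∈ E (suc c) × u ∈ E (par′ c) × lam u ≡ par′ c
    parent-witness c with proj₁ (new c)
    ... | u , u∈c , _ , λu≡par′c =
      u , u∈c , subst (λ p → u ∈ E p) λu≡par′c (proj₁ (isλ u)) , λu≡par′c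

    edge-witness′ : ∀ {y z} → TreeAdj par′ y z →
                    Σ (Fin n) λ u → u ∈ E y ∩ E z × (lam u ≡ y ⊎ lam u ≡ z)
    edge-witness′ (inj₁ (c , refl , refl)) with parent-witness c
    ... | u , u∈y , u∈z , λu≡z = u , x∈p∩q⁺ (u∈y , u∈z) , inj₂ λu≡z
    edge-witness′ (inj₂ (c , refl , refl)) with parent-witness c
    ... | u , u∈z , u∈y , λu≡y = u , x∈p∩q⁺ (u∈y , u∈z) , inj₁ λu≡y

    module _ {r : ℕ} {x : Fin (suc (suc r)) → Fin (suc k)} (x-injective : Injective _≡_ _≡_ x)
             (x-adj : ∀ t → TreeAdj par′ (x (inject₁ t)) (x (suc t))) where

      Top : Fin (suc (suc r)) → Set
      Top s = ∀ i → Desc par′ (x s) (x i)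

      Qualifying : Fin (suc r) → Set
      Qualifying t = Sep E r x t ⊆ Sep E r x zero × Sep E r x t ⊆ Sep E r x (fromℕ r)

      qualifying⇒incident-top : ∀ t → Qualifying t →
        Σ (Fin (suc (suc r))) λ s → (toℕ t ℕ.≤ toℕ s × toℕ s ℕ.≤ suc (toℕ t)) × Top s
      qualifying⇒incident-top t (⊆₀ , ⊆ₗ) with edge-witness′ (x-adj t)
      ... | u , u∈t , λu≡end = endpoint λu≡end
        where
          top : ∀ s → lam u ≡ x s → Top s
          top s λu≡s = path-below x-injective x-adj s
            (below (proj₁ (x∈p∩q⁻ _ _ (⊆₀ u∈t)))) (below (proj₂ (x∈p∩q⁻ _ _ (⊆ₗ u∈t))))
            where
              below : ∀ {q} → u ∈ E q → Desc par′ (x s) q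
              below u∈q = subst (λ p → Desc par′ p _) λu≡s (λ-is-ancestor′ _ u∈q)
          endpoint : lam u ≡ x (inject₁ t) ⊎ lam u ≡ x (suc t) →
            Σ (Fin (suc (suc r))) λ s → (toℕ t ℕ.≤ toℕ s × toℕ s ℕ.≤ suc (toℕ t)) × Top s
          endpoint (inj₁ λu≡t) =
            inject₁ t , (ℕ.≤-reflexive (sym (toℕ-inject₁ t)) ,
                         ℕ.≤-trans (ℕ.≤-reflexive (toℕ-inject₁ t)) (ℕ.n≤1+n _)) , top _ λu≡t
          endpoint (inj₂ λu≡t+1) = suc t , (ℕ.n≤1+n _ , ℕ.≤-refl) , top _ λu≡t+1

      top-unique : ∀ {s s′} → Top s → Top s′ → s ≡ s′
      top-unique top top′ = x-injective (Desc-antisym earlier′ (top _) (top′ _))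

      qualifying-≤-suc : ∀ {t t′} → Qualifying t → Qualifying t′ → toℕ t′ ℕ.≤ suc (toℕ t)
      qualifying-≤-suc {t} {t′} q q′
        with qualifying⇒incident-top t q | qualifying⇒incident-top t′ q′
      ... | s , (_ , s≤t+1) , top | s′ , (t′≤s′ , _) , top′ =
        ℕ.≤-trans t′≤s′ (subst (λ p → toℕ p ℕ.≤ suc (toℕ t)) (top-unique top top′) s≤t+1)

lemma6 : ∀ {n k} (E : Hypergraph n (suc k)) (par : ParentFn k) →
    IsHypergraph E → IsJoinTree E par → IsPreorder par →
    (lam : Fin n → Fin (suc k)) → IsLambda E lam →
    (par' : ParentFn k) → IsNewParent E lam par' →
    (a b : Fin (suc k)) → a ≢ b →
    (r : ℕ) (x : Fin (suc (suc r)) → Fin (suc k)) → IsPath par' a b r x →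
    (t₁ t₂ t₃ : Fin (suc r)) → t₁ < t₂ → t₂ < t₃ →
    (Sep E r x t₁ ⊆ Sep E r x zero × Sep E r x t₁ ⊆ Sep E r x (fromℕ r)) →
    (Sep E r x t₂ ⊆ Sep E r x zero × Sep E r x t₂ ⊆ Sep E r x (fromℕ r)) →
    (Sep E r x t₃ ⊆ Sep E r x zero × Sep E r x t₃ ⊆ Sep E r x (fromℕ r)) → ⊥
lemma6 E par _ join (earlier , _) lam isλ par′ new _ _ _ r x (_ , _ , x-injective , x-adj)
       t₁ t₂ t₃ t₁<t₂ t₂<t₃ q₁ _ q₃ =
  ℕ.<⇒≱ (ℕ.≤-<-trans t₁<t₂ t₂<t₃) (qualifying-≤-suc x-injective x-adj q₁ q₃)
  where
    open JoinTree E par join earlier lam isλ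
    open NewParent par′ new
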